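{- For all finite simple graphs $G$ and $W$ and every positive integer $k$, $\alpha_k(G\boxtimes W)\le \alpha^{*}(G)\,\alpha_k(W)$.
   Context: For a finite simple graph $G$ and a positive integer $k$, $\alpha_k(G)$ is the maximum of $\sum_{v} x_v$ over $x\in \mathbb{Z}_{\ge 0}^{V(G)}$ with $\sum_{v\in C} x_v\le k$ for every clique $C$ of $G$. The fractional packing number $\alpha^{*}(G)$ is the maximum of $\sum_v x_v$ over real $x\ge 0$ with $\sum_{v\in C}x_v\le 1$ for every clique $C$ of $G$. The strong product $G \boxtimes W$ has vertex set $V(G)\times V(W)$, with distinct $(u_1,v_1),(u_2,v_2)$ adjacent iff ($u_1=u_2$ or $u_1u_2\in E(G)$) and ($v_1=v_2$ or $v_1v_2\in E(W)$). -}

module Defs where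

open import Data.Nat using (ℕ; zero; suc; _*_) renaming (_+_ to _+ℕ_; _≤_ to _≤ℕ_)
open import Data.Fin using (Fin; zero; suc; remQuot; _≟_)
open import Data.Bool using (Bool; true; false; _∧_; _∨_; not; if_then_else_)
open import Data.Product using (_×_; _,_; proj₁; proj₂)
open import Data.Integer using (+_)
open import Data.Rational using (ℚ; 0ℚ; _/_) renaming (_+_ to _+ℚ_; _≤_ to _≤ℚ_)
open import Relation.Nullary using (¬_)
open import Relation.Nullary.Decidable using (⌊_⌋)
open import Relation.Binary.PropositionalEquality using (_≡_)

record Graph : Set where
  field
    n      : ℕ
    adj    : Fin n → Fin n → Bool
    sym    : ∀ u v → adj u v ≡ adj v u
    irrefl : ∀ v → adj v v ≡ false

open Graph public

sumℕ : ∀ {m} → (Fin m → ℕ) → ℕ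
sumℕ {zero}  f = 0
sumℕ {suc m} f = f zero +ℕ sumℕ (λ i → f (suc i))

sumℚ : ∀ {m} → (Fin m → ℚ) → ℚ
sumℚ {zero}  f = 0ℚ
sumℚ {suc m} f = f zero +ℚ sumℚ (λ i → f (suc i))

toℚ : ℕ → ℚ
toℚ k = + k / 1

-- Stated for an arbitrary adjacency relation on Fin m (used both for G and
-- for the strong product, whose adjacency is given by strongAdj below).
IsCliqueA : ∀ {m} → (Fin m → Fin m → Bool) → (Fin m → Bool) → Set
IsCliqueA A C = ∀ u v → C u ≡ true → C v ≡ true → ¬ (u ≡ v) → A u v ≡ true

IsClique : (G : Graph) → (Fin (n G) → Bool) → Set
IsClique G C = IsCliqueA (adj G) C

cliqueSumℕ : ∀ {m} → (Fin m → Bool) → (Fin m → ℕ) → ℕ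
cliqueSumℕ C x = sumℕ (λ v → if C v then x v else 0)

cliqueSumℚ : (G : Graph) → (Fin (n G) → Bool) → (Fin (n G) → ℚ) → ℚ
cliqueSumℚ G C y = sumℚ (λ v → if C v then y v else 0ℚ)

-- x ∈ ℤ≥0^V(G) is feasible for α_k(G): every clique has weight ≤ k.
IsKPackingA : ∀ {m} → (Fin m → Fin m → Bool) → ℕ → (Fin m → ℕ) → Set
IsKPackingA A k x = ∀ C → IsCliqueA A C → cliqueSumℕ C x ≤ℕ k

IsKPacking : (G : Graph) → ℕ → (Fin (n G) → ℕ) → Set
IsKPacking G k x = IsKPackingA (adj G) k x

-- y ∈ ℚ≥0^V(G) is feasible for α*(G): y ≥ 0 and every clique has weight ≤ 1.
IsFracPacking : (G : Graph) → (Fin (n G) → ℚ) → Set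
IsFracPacking G y = (∀ v → 0ℚ ≤ℚ y v) × (∀ C → IsClique G C → cliqueSumℚ G C y ≤ℚ toℚ 1)

eqOrAdj : (G : Graph) → Fin (n G) → Fin (n G) → Bool
eqOrAdj G u v = ⌊ u ≟ v ⌋ ∨ adj G u v

-- Strong product G ⊠ W, vertex set Fin (n G * n W) ≅ Fin (n G) × Fin (n W) via remQuot.
strongAdj : (G W : Graph) → Fin (n G * n W) → Fin (n G * n W) → Bool
strongAdj G W p q =
  not ⌊ p ≟ q ⌋ ∧ (eqOrAdj G (proj₁ (remQuot {n G} (n W) p)) (proj₁ (remQuot {n G} (n W) q))
                ∧ eqOrAdj W (proj₂ (remQuot {n G} (n W) p)) (proj₂ (remQuot {n G} (n W) q)))

{-# OPTIONS --safe #-}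

-- Write x(u, w) for the weight of a k-packing x of G ⊠ W and s(u) = Σ_w x(u, w) for its
-- row sums. For a clique C of G and a clique K of W the set C × K is a clique of G ⊠ W,
-- so the column sums z_C(w) = Σ_{u ∈ C} x(u, w) form a k-packing of W, of total weight
-- s(C). Choosing C of maximum weight M = s(C), every clique of G has s-weight at most M,
-- hence y = s / M is a fractional packing of G, and Σ x = Σ s = (Σ y) · M = (Σ y)(Σ z_C).

module Submission where

open import Defs hiding (sym)
open import Algebra.Bundles using (Ring)
import Algebra.Properties.Semiring.Sum as SemiringSum
open import Data.Bool using (Bool; true; false; _∧_; if_then_else_)
open import Data.Bool.Properties
  using (∧-conicalˡ; ∧-conicalʳ; if-∧; if-swap-then) renaming (_≟_ to _≟ᵇ_)
open import Data.Empty using (⊥-elim)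
open import Data.Fin using (Fin; zero; suc; _↑ˡ_; _↑ʳ_; combine; remQuot; _≟_)
open import Data.Fin.Properties using (all?; remQuot-combine)
import Data.Integer as ℤ
import Data.Integer.Properties as ℤP
open import Data.Integer using (+_)
open import Data.Nat using (ℕ; zero; suc; _+_; _*_; _≤_; z≤n; NonZero)
import Data.Nat.Properties as ℕP
open import Data.Product using (Σ; _×_; _,_; proj₁; proj₂)
open import Data.Rational as ℚ using (ℚ; 0ℚ; 1ℚ; 1/_)
  renaming (_+_ to _+ℚ_; _*_ to _*ℚ_; _≤_ to _≤ℚ_)
import Data.Rational.Properties as ℚP
import Data.Rational.Unnormalised as ℚᵘ
import Data.Rational.Unnormalised.Properties as ℚᵘP
open import Data.Sum using (_⊎_; inj₁; inj₂)
open import Data.Vec.Functional using (_∷_; head; tail)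
open import Data.Vec.Functional.Properties using (∷-cong)
open import Relation.Nullary using (¬_; Dec; yes; no)
open import Relation.Nullary.Decidable using (⌊_⌋; ¬?; _→-dec_)
open import Relation.Binary.PropositionalEquality as ≡
  using (_≡_; refl; trans; cong; cong₂; subst; subst₂; _≗_; module ≡-Reasoning)

toℚᵘ-toℚ : ∀ a → ℚ.toℚᵘ (toℚ a) ℚᵘ.≃ ℚᵘ.mkℚᵘ (+ a) 0
toℚᵘ-toℚ a = ℚP.toℚᵘ-fromℚᵘ (ℚᵘ.mkℚᵘ (+ a) 0)

toℚ-+ : ∀ a b → toℚ (a + b) ≡ toℚ a +ℚ toℚ b
toℚ-+ a b = ℚP.toℚᵘ-injective (begin
  ℚ.toℚᵘ (toℚ (a + b))                  ≈⟨ toℚᵘ-toℚ (a + b) ⟩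
  ℚᵘ.mkℚᵘ (+ (a + b)) 0                  ≈⟨ ℚᵘ.*≡* numerators ⟩
  ℚᵘ.mkℚᵘ (+ a) 0 ℚᵘ.+ ℚᵘ.mkℚᵘ (+ b) 0  ≈⟨ ℚᵘP.+-cong (toℚᵘ-toℚ a) (toℚᵘ-toℚ b) ⟨
  ℚ.toℚᵘ (toℚ a) ℚᵘ.+ ℚ.toℚᵘ (toℚ b)    ≈⟨ ℚP.toℚᵘ-homo-+ (toℚ a) (toℚ b) ⟨
  ℚ.toℚᵘ (toℚ a +ℚ toℚ b)               ∎)
  where
  open import Relation.Binary.Reasoning.Setoid ℚᵘP.≃-setoid
  numerators : + (a + b) ℤ.* + 1 ≡ (+ a ℤ.* + 1 ℤ.+ + b ℤ.* + 1) ℤ.* + 1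
  numerators = trans (ℤP.*-identityʳ _) (≡.sym (trans (ℤP.*-identityʳ _)
                 (cong₂ ℤ._+_ (ℤP.*-identityʳ (+ a)) (ℤP.*-identityʳ (+ b)))))

toℚ-mono-≤ : ∀ {a b} → a ≤ b → toℚ a ≤ℚ toℚ b
toℚ-mono-≤ {a} {b} a≤b = ℚP.toℚᵘ-cancel-≤ (begin
  ℚ.toℚᵘ (toℚ a)     ≃⟨ toℚᵘ-toℚ a ⟩
  ℚᵘ.mkℚᵘ (+ a) 0    ≤⟨ ℚᵘ.*≤* (ℤP.*-monoʳ-≤-nonNeg (+ 1) (ℤ.+≤+ a≤b)) ⟩
  ℚᵘ.mkℚᵘ (+ b) 0    ≃⟨ toℚᵘ-toℚ b ⟨
  ℚ.toℚᵘ (toℚ b)     ∎)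
  where open ℚᵘP.≤-Reasoning

module ℕΣ = SemiringSum ℕP.+-*-semiring
module ℚΣ = SemiringSum (Ring.semiring ℚP.+-*-ring)

sumℕ≡sum : ∀ {m} (f : Fin m → ℕ) → sumℕ f ≡ ℕΣ.sum f
sumℕ≡sum {zero}  f = refl
sumℕ≡sum {suc m} f = cong (_+_ (f zero)) (sumℕ≡sum (λ i → f (suc i)))

sumℚ≡sum : ∀ {m} (f : Fin m → ℚ) → sumℚ f ≡ ℚΣ.sum f
sumℚ≡sum {zero}  f = refl
sumℚ≡sum {suc m} f = cong (f zero +ℚ_) (sumℚ≡sum (λ i → f (suc i)))

sumℕ-cong : ∀ {m} {f g : Fin m → ℕ} → f ≗ g → sumℕ f ≡ sumℕ g
sumℕ-cong {f = f} {g} f≗g =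
  trans (sumℕ≡sum f) (trans (ℕΣ.sum-cong-≗ f≗g) (≡.sym (sumℕ≡sum g)))

sumℕ-zero : ∀ m → sumℕ {m} (λ _ → 0) ≡ 0
sumℕ-zero m = trans (sumℕ≡sum (λ (_ : Fin m) → 0)) (ℕΣ.sum-replicate-zero m)

sumℕ-comm : ∀ {l m} (f : Fin l → Fin m → ℕ) →
            sumℕ (λ u → sumℕ (f u)) ≡ sumℕ (λ w → sumℕ (λ u → f u w))
sumℕ-comm f = begin
  sumℕ (λ u → sumℕ (f u))             ≡⟨ sumℕ-cong (λ u → sumℕ≡sum (f u)) ⟩
  sumℕ (λ u → ℕΣ.sum (f u))           ≡⟨ sumℕ≡sum (λ u → ℕΣ.sum (f u)) ⟩
  ℕΣ.sum (λ u → ℕΣ.sum (f u))         ≡⟨ ℕΣ.∑-comm f ⟩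
  ℕΣ.sum (λ w → ℕΣ.sum (λ u → f u w)) ≡⟨ sumℕ≡sum (λ w → ℕΣ.sum (λ u → f u w)) ⟨
  sumℕ (λ w → ℕΣ.sum (λ u → f u w))   ≡⟨ sumℕ-cong (λ w → sumℕ≡sum (λ u → f u w)) ⟨
  sumℕ (λ w → sumℕ (λ u → f u w))     ∎
  where open ≡-Reasoning

sumℕ-↑ : ∀ l m (f : Fin (l + m) → ℕ) →
         sumℕ f ≡ sumℕ (λ i → f (i ↑ˡ m)) + sumℕ (λ j → f (l ↑ʳ j))
sumℕ-↑ zero    m f = refl
sumℕ-↑ (suc l) m f =
  trans (cong (_+_ (f zero)) (sumℕ-↑ l m (λ i → f (suc i)))) (≡.sym (ℕP.+-assoc (f zero) _ _))

sumℕ-combine : ∀ l m (f : Fin (l * m) → ℕ) →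
               sumℕ f ≡ sumℕ (λ u → sumℕ (λ w → f (combine {l} {m} u w)))
sumℕ-combine zero    m f = refl
sumℕ-combine (suc l) m f =
  trans (sumℕ-↑ m (l * m) f) (cong (_+_ (sumℕ (λ w → f (w ↑ˡ (l * m)))))
                                   (sumℕ-combine l m (λ i → f (m ↑ʳ i))))

if-sumℕ : ∀ b {m} (f : Fin m → ℕ) →
          (if b then sumℕ f else 0) ≡ sumℕ (λ i → if b then f i else 0)
if-sumℕ true  f = refl
if-sumℕ false {m} f = ≡.sym (sumℕ-zero m)

term≤sumℕ : ∀ {m} (f : Fin m → ℕ) i → f i ≤ sumℕ f
term≤sumℕ f zero    = ℕP.m≤m+n _ _
term≤sumℕ f (suc i) = ℕP.≤-trans (term≤sumℕ (λ j → f (suc j)) i) (ℕP.m≤n+m _ (f zero))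

sumℚ-cong : ∀ {m} {f g : Fin m → ℚ} → f ≗ g → sumℚ f ≡ sumℚ g
sumℚ-cong {f = f} {g} f≗g =
  trans (sumℚ≡sum f) (trans (ℚΣ.sum-cong-≗ f≗g) (≡.sym (sumℚ≡sum g)))

sumℚ-*ʳ : ∀ {m} (f : Fin m → ℚ) r → sumℚ (λ i → f i *ℚ r) ≡ sumℚ f *ℚ r
sumℚ-*ʳ f r = trans (sumℚ≡sum (λ i → f i *ℚ r))
  (trans (≡.sym (ℚΣ.*-distribʳ-sum r f)) (cong (_*ℚ r) (≡.sym (sumℚ≡sum f))))

toℚ-sumℕ : ∀ {m} (f : Fin m → ℕ) → toℚ (sumℕ f) ≡ sumℚ (λ i → toℚ (f i))
toℚ-sumℕ {zero}  f = refl
toℚ-sumℕ {suc m} f =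
  trans (toℚ-+ (f zero) _) (cong (toℚ (f zero) +ℚ_) (toℚ-sumℕ (λ i → f (suc i))))

toℚ-if-* : ∀ b a r → (if b then toℚ a *ℚ r else 0ℚ) ≡ toℚ (if b then a else 0) *ℚ r
toℚ-if-* true  a r = refl
toℚ-if-* false a r = ≡.sym (ℚP.*-zeroˡ r)

toℚ-cliqueSumℕ-* : ∀ {m} (C : Fin m → Bool) (f : Fin m → ℕ) r →
  sumℚ (λ v → if C v then toℚ (f v) *ℚ r else 0ℚ) ≡ toℚ (cliqueSumℕ C f) *ℚ r
toℚ-cliqueSumℕ-* C f r = begin
  sumℚ (λ v → if C v then toℚ (f v) *ℚ r else 0ℚ)
    ≡⟨ sumℚ-cong (λ v → toℚ-if-* (C v) (f v) r) ⟩
  sumℚ (λ v → toℚ (if C v then f v else 0) *ℚ r)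
    ≡⟨ sumℚ-*ʳ (λ v → toℚ (if C v then f v else 0)) r ⟩
  sumℚ (λ v → toℚ (if C v then f v else 0)) *ℚ r
    ≡⟨ cong (_*ℚ r) (toℚ-sumℕ (λ v → if C v then f v else 0)) ⟨
  toℚ (cliqueSumℕ C f) *ℚ r ∎
  where open ≡-Reasoning

record Maximiser {m} (P : (Fin m → Bool) → Set) (f : (Fin m → Bool) → ℕ) : Set where
  field
    argmax  : Fin m → Bool
    holds   : P argmax
    maximal : ∀ D → P D → f D ≤ f argmax

open Maximiser

head∷tail≗ : ∀ {m} (D : Fin (suc m) → Bool) → head D ∷ tail D ≗ D
head∷tail≗ D = ∷-cong refl (λ _ → refl)

-- Subsets are compared pointwise: head D ∷ tail D is not definitionally D, hence the
-- hypotheses that P and f respect _≗_.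
maximiser? : ∀ {m} (P : (Fin m → Bool) → Set) (f : (Fin m → Bool) → ℕ) →
  (∀ C → Dec (P C)) → (∀ {C D} → C ≗ D → P C → P D) → (∀ {C D} → C ≗ D → f C ≡ f D) →
  (∀ C → ¬ P C) ⊎ Maximiser P f
maximiser? {zero} P f P? P-resp f-resp with P? (λ ())
... | yes p  = inj₂ (record { argmax = λ () ; holds = p
                           ; maximal = λ D _ → ℕP.≤-reflexive (f-resp (λ ())) })
... | no ¬p = inj₁ (λ D pD → ¬p (P-resp (λ ()) pD))
maximiser? {suc m} P f P? P-resp f-resp = join (restrict true) (restrict false)
  where
  restrict : ∀ b → (∀ C → ¬ P (b ∷ C)) ⊎ Maximiser (λ C → P (b ∷ C)) (λ C → f (b ∷ C))
  restrict b = maximiser? (λ C → P (b ∷ C)) (λ C → f (b ∷ C)) (λ C → P? (b ∷ C))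
    (λ C≗D → P-resp (∷-cong refl C≗D)) (λ C≗D → f-resp (∷-cong refl C≗D))

  resp∷ : ∀ D → P D → P (head D ∷ tail D)
  resp∷ D = P-resp (λ i → ≡.sym (head∷tail≗ D i))

  none : (∀ b C → ¬ P (b ∷ C)) → ∀ D → ¬ P D
  none h D pD = h (head D) (tail D) (resp∷ D pD)

  extend : ∀ b (M : Maximiser (λ C → P (b ∷ C)) (λ C → f (b ∷ C))) →
           (∀ b′ C → P (b′ ∷ C) → f (b′ ∷ C) ≤ f (b ∷ argmax M)) → Maximiser P f
  extend b M h = record
    { argmax  = b ∷ argmax M
    ; holds   = holds M
    ; maximal = λ D pD → subst (_≤ f (b ∷ argmax M)) (f-resp (head∷tail≗ D))
                               (h (head D) (tail D) (resp∷ D pD))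
    }

  join : (∀ C → ¬ P (true ∷ C)) ⊎ Maximiser (λ C → P (true ∷ C)) (λ C → f (true ∷ C)) →
         (∀ C → ¬ P (false ∷ C)) ⊎ Maximiser (λ C → P (false ∷ C)) (λ C → f (false ∷ C)) →
         (∀ C → ¬ P C) ⊎ Maximiser P f
  join (inj₁ ¬T) (inj₁ ¬F) = inj₁ (none λ { true → ¬T ; false → ¬F })
  join (inj₂ T)  (inj₁ ¬F) =
    inj₂ (extend true T λ { true → maximal T ; false C p → ⊥-elim (¬F C p) })
  join (inj₁ ¬T) (inj₂ F)  =
    inj₂ (extend false F λ { true C p → ⊥-elim (¬T C p) ; false → maximal F })
  join (inj₂ T)  (inj₂ F)  with ℕP.≤-total (f (true ∷ argmax T)) (f (false ∷ argmax F))
  ... | inj₁ T≤F = inj₂ (extend false F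
                     λ { true C p → ℕP.≤-trans (maximal T C p) T≤F ; false → maximal F })
  ... | inj₂ F≤T = inj₂ (extend true T
                     λ { true → maximal T ; false C p → ℕP.≤-trans (maximal F C p) F≤T })

eqOrAdj-clique : ∀ (G : Graph) {C} → IsClique G C →
                 ∀ {u v} → C u ≡ true → C v ≡ true → eqOrAdj G u v ≡ true
eqOrAdj-clique G C-clique {u} {v} u∈C v∈C with u ≟ v
... | yes _   = refl
... | no u≢v = C-clique u v u∈C v∈C u≢v

isClique? : ∀ (G : Graph) C → Dec (IsClique G C)
isClique? G C = all? λ u → all? λ v →
  (C u ≟ᵇ true) →-dec (C v ≟ᵇ true) →-dec ¬? (u ≟ v) →-dec (adj G u v ≟ᵇ true)

isClique-resp-≗ : ∀ (G : Graph) {C D} → C ≗ D → IsClique G C → IsClique G D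
isClique-resp-≗ G C≗D C-clique u v u∈D v∈D =
  C-clique u v (trans (C≗D u) u∈D) (trans (C≗D v) v∈D)

singleton : ∀ {m} → Fin m → Fin m → Bool
singleton u v = ⌊ v ≟ u ⌋

singleton-isClique : ∀ (G : Graph) u → IsClique G (singleton u)
singleton-isClique G u v v′ v∈ v′∈ v≢v′ with v ≟ u | v′ ≟ u
... | yes refl | yes refl = ⊥-elim (v≢v′ refl)

cliqueSumℕ-singleton : ∀ {m} (f : Fin m → ℕ) u → f u ≤ cliqueSumℕ (singleton u) f
cliqueSumℕ-singleton f u = subst (_≤ cliqueSumℕ (singleton u) f) (if-self u)
  (term≤sumℕ (λ v → if singleton u v then f v else 0) u)
  where
  if-self : ∀ u → (if ⌊ u ≟ u ⌋ then f u else 0) ≡ f u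
  if-self u with u ≟ u
  ... | yes _   = refl
  ... | no u≢u = ⊥-elim (u≢u refl)

heaviestClique : ∀ (G : Graph) (s : Fin (n G) → ℕ) →
                 Maximiser (IsClique G) (λ C → cliqueSumℕ C s)
heaviestClique G s with maximiser? (IsClique G) (λ C → cliqueSumℕ C s) (isClique? G)
  (isClique-resp-≗ G) (λ C≗D → sumℕ-cong (λ u → cong (λ b → if b then s u else 0) (C≗D u)))
... | inj₁ noClique = ⊥-elim (noClique (λ _ → false) (λ _ _ ()))
... | inj₂ heaviest = heaviest

module _ (G : Graph) (s : Fin (n G) → ℕ) (M : ℕ)
         (cliques≤M : ∀ C → IsClique G C → cliqueSumℕ C s ≤ M) where

  weight≤cliqueBound : ∀ u → s u ≤ M
  weight≤cliqueBound u =
    ℕP.≤-trans (cliqueSumℕ-singleton s u) (cliques≤M (singleton u) (singleton-isClique G u))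

  scaled-isFracPacking : ∀ r .{{_ : ℚ.NonNegative r}} → toℚ M *ℚ r ≤ℚ 1ℚ →
                         IsFracPacking G (λ v → toℚ (s v) *ℚ r)
  scaled-isFracPacking r Mr≤1 = nonNeg , cliques≤1
    where
    nonNeg : ∀ v → 0ℚ ≤ℚ toℚ (s v) *ℚ r
    nonNeg v = subst (_≤ℚ toℚ (s v) *ℚ r) (ℚP.*-zeroˡ r)
                     (ℚP.*-monoʳ-≤-nonNeg r (toℚ-mono-≤ {0} {s v} z≤n))
    cliques≤1 : ∀ C → IsClique G C → cliqueSumℚ G C (λ v → toℚ (s v) *ℚ r) ≤ℚ 1ℚ
    cliques≤1 C C-clique = begin
      cliqueSumℚ G C (λ v → toℚ (s v) *ℚ r)
        ≡⟨ toℚ-cliqueSumℕ-* C s r ⟩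
      toℚ (cliqueSumℕ C s) *ℚ r
        ≤⟨ ℚP.*-monoʳ-≤-nonNeg r (toℚ-mono-≤ (cliques≤M C C-clique)) ⟩
      toℚ M *ℚ r
        ≤⟨ Mr≤1 ⟩
      1ℚ ∎
      where open ℚP.≤-Reasoning

cliqueBound⇒fracPacking : ∀ (G : Graph) (s : Fin (n G) → ℕ) M →
  (∀ C → IsClique G C → cliqueSumℕ C s ≤ M) →
  Σ (Fin (n G) → ℚ) λ y → IsFracPacking G y × toℚ (sumℕ s) ≤ℚ sumℚ y *ℚ toℚ M
-- When M = 0 every weight s u vanishes, so y = 0 suffices.
cliqueBound⇒fracPacking G s zero cliques≤0 =
  y , scaled-isFracPacking G s 0 cliques≤0 0ℚ (toℚ-mono-≤ {0} {1} z≤n) ,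
  ℚP.≤-reflexive (trans (cong toℚ sumℕ-s≡0) (≡.sym (ℚP.*-zeroʳ (sumℚ y))))
  where
  y : Fin (n G) → ℚ
  y v = toℚ (s v) *ℚ 0ℚ
  sumℕ-s≡0 : sumℕ s ≡ 0
  sumℕ-s≡0 = trans (sumℕ-cong (λ u → ℕP.n≤0⇒n≡0 (weight≤cliqueBound G s 0 cliques≤0 u)))
                   (sumℕ-zero (n G))
cliqueBound⇒fracPacking G s M@(suc _) cliques≤M =
  y , scaled-isFracPacking G s M cliques≤M r (ℚP.≤-reflexive (ℚP.*-inverseʳ (toℚ M))) ,
  ℚP.≤-reflexive (≡.sym (begin
    sumℚ y *ℚ toℚ M                ≡⟨ cong (_*ℚ toℚ M) (toℚ-cliqueSumℕ-* (λ _ → true) s r) ⟩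
    (toℚ (sumℕ s) *ℚ r) *ℚ toℚ M   ≡⟨ ℚP.*-assoc (toℚ (sumℕ s)) r (toℚ M) ⟩
    toℚ (sumℕ s) *ℚ (r *ℚ toℚ M)   ≡⟨ cong (toℚ (sumℕ s) *ℚ_) (ℚP.*-inverseˡ (toℚ M)) ⟩
    toℚ (sumℕ s) *ℚ 1ℚ             ≡⟨ ℚP.*-identityʳ (toℚ (sumℕ s)) ⟩
    toℚ (sumℕ s)                   ∎))
  where
  open ≡-Reasoning
  instance
    M-positive : ℚ.Positive (toℚ M)
    M-positive = ℚP.normalize-pos M 1
    M-nonZero : ℚ.NonZero (toℚ M)
    M-nonZero = ℚP.pos⇒nonZero (toℚ M)
  r : ℚ
  r = 1/ toℚ M
  instance
    r-nonNegative : ℚ.NonNegative r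
    r-nonNegative = ℚP.pos⇒nonNeg r {{ℚP.1/pos⇒pos (toℚ M)}}
  y : Fin (n G) → ℚ
  y v = toℚ (s v) *ℚ r

module StrongProduct (G W : Graph) where

  row : Fin (n G * n W) → Fin (n G)
  row p = proj₁ (remQuot {n G} (n W) p)

  column : Fin (n G * n W) → Fin (n W)
  column p = proj₂ (remQuot {n G} (n W) p)

  _⊠ᶜ_ : (Fin (n G) → Bool) → (Fin (n W) → Bool) → Fin (n G * n W) → Bool
  (C ⊠ᶜ K) p = C (row p) ∧ K (column p)

  ⊠ᶜ-isClique : ∀ {C K} → IsClique G C → IsClique W K → IsCliqueA (strongAdj G W) (C ⊠ᶜ K)
  ⊠ᶜ-isClique {C} {K} C-clique K-clique p q p∈ q∈ p≢q with p ≟ q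
  ... | yes p≡q = ⊥-elim (p≢q p≡q)
  ... | no _    = cong₂ _∧_
    (eqOrAdj-clique G C-clique (∧-conicalˡ (C (row p)) _ p∈) (∧-conicalˡ (C (row q)) _ q∈))
    (eqOrAdj-clique W K-clique (∧-conicalʳ (C (row p)) _ p∈) (∧-conicalʳ (C (row q)) _ q∈))

  ⊠ᶜ-combine : ∀ C K u w → (C ⊠ᶜ K) (combine u w) ≡ C u ∧ K w
  ⊠ᶜ-combine C K u w = cong (λ (u′ , w′) → C u′ ∧ K w′) (remQuot-combine u w)

  module Weights (x : Fin (n G * n W) → ℕ) where

    entry : Fin (n G) → Fin (n W) → ℕ
    entry u w = x (combine u w)

    rowSum : Fin (n G) → ℕ
    rowSum u = sumℕ (entry u)

    columnSum : (Fin (n G) → Bool) → Fin (n W) → ℕ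
    columnSum C w = cliqueSumℕ C (λ u → entry u w)

    sumℕ-rowSum : sumℕ x ≡ sumℕ rowSum
    sumℕ-rowSum = sumℕ-combine (n G) (n W) x

    sumℕ-columnSum : ∀ C → sumℕ (columnSum C) ≡ cliqueSumℕ C rowSum
    sumℕ-columnSum C = trans (≡.sym (sumℕ-comm (λ u w → if C u then entry u w else 0)))
                             (sumℕ-cong (λ u → ≡.sym (if-sumℕ (C u) (entry u))))

    cliqueSumℕ-⊠ᶜ : ∀ C K → cliqueSumℕ (C ⊠ᶜ K) x ≡ cliqueSumℕ K (columnSum C)
    cliqueSumℕ-⊠ᶜ C K = begin
      sumℕ (λ p → if (C ⊠ᶜ K) p then x p else 0)
        ≡⟨ sumℕ-combine (n G) (n W) _ ⟩
      sumℕ (λ u → sumℕ (λ w → if (C ⊠ᶜ K) (combine u w) then entry u w else 0))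
        ≡⟨ sumℕ-cong (λ u → sumℕ-cong (λ w → in-product u w)) ⟩
      sumℕ (λ u → sumℕ (λ w → if K w then (if C u then entry u w else 0) else 0))
        ≡⟨ sumℕ-comm (λ u w → if K w then (if C u then entry u w else 0) else 0) ⟩
      sumℕ (λ w → sumℕ (λ u → if K w then (if C u then entry u w else 0) else 0))
        ≡⟨ sumℕ-cong (λ w → if-sumℕ (K w) (λ u → if C u then entry u w else 0)) ⟨
      sumℕ (λ w → if K w then columnSum C w else 0)
        ∎
      where
      open ≡-Reasoning
      in-product : ∀ u w → (if (C ⊠ᶜ K) (combine u w) then entry u w else 0)
                         ≡ (if K w then (if C u then entry u w else 0) else 0)
      in-product u w = trans (cong (λ b → if b then entry u w else 0) (⊠ᶜ-combine C K u w))
                             (trans (if-∧ (C u)) (if-swap-then (C u) (K w)))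

    columnSum-isKPacking : ∀ {k C} → IsKPackingA (strongAdj G W) k x → IsClique G C →
                           IsKPacking W k (columnSum C)
    columnSum-isKPacking {k} {C} x-packing C-clique K K-clique =
      subst (_≤ k) (cliqueSumℕ-⊠ᶜ C K) (x-packing (C ⊠ᶜ K) (⊠ᶜ-isClique C-clique K-clique))

mainTheorem8 : (G W : Graph) (k : ℕ) → .{{_ : NonZero k}} →
    (x : Fin (n G * n W) → ℕ) → IsKPackingA (strongAdj G W) k x →
    Σ (Fin (n G) → ℚ) λ y → Σ (Fin (n W) → ℕ) λ z →
    IsFracPacking G y × IsKPacking W k z ×
    (toℚ (sumℕ x) ≤ℚ (sumℚ y *ℚ toℚ (sumℕ z)))
mainTheorem8 G W k x x-packing =
  let y , y-isFracPacking , sumℕ-rowSum≤ =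
        cliqueBound⇒fracPacking G rowSum (cliqueSumℕ C* rowSum) (maximal heaviest)
  in  y , columnSum C* , y-isFracPacking , columnSum-isKPacking x-packing (holds heaviest) ,
      subst₂ (λ a b → toℚ a ≤ℚ sumℚ y *ℚ toℚ b)
             (≡.sym sumℕ-rowSum) (≡.sym (sumℕ-columnSum C*)) sumℕ-rowSum≤
  where
  open StrongProduct G W
  open Weights x
  heaviest : Maximiser (IsClique G) (λ C → cliqueSumℕ C rowSum)
  heaviest = heaviestClique G rowSum
  C* : Fin (n G) → Bool
  C* = argmax heaviest
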